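{- For every integer $n\ge 2$, $|B_n(132,213,321)|=n-1$.
   Context: A permutation $\sigma\in S_n$ is written as $\sigma(1)\cdots\sigma(n)$. An index $i\in[n-1]$ is an ascent if $\sigma(i)<\sigma(i+1)$ and a descent if $\sigma(i)>\sigma(i+1)$. A ballot permutation is a permutation such that every prefix $\sigma(1)\cdots\sigma(p)$ has at least as many ascents as descents. $\sigma$ contains a pattern $\pi\in S_k$ if some subsequence $\sigma(c_1)\cdots\sigma(c_k)$ with $c_1<\dots<c_k$ is order-isomorphic to $\pi$, and avoids $\pi$ otherwise. $B_n(\pi_1,\dots,\pi_m)$ denotes the set of ballot permutations of length $n$ avoiding all of $\pi_1,\dots,\pi_m$. -}

module Defs where

open import Data.Nat using (ℕ; zero; suc; _≤_; _<_; _<?_; _+_)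
open import Data.Fin using (Fin; toℕ; fromℕ<) renaming (zero to fz; suc to fs)
open import Data.Fin using () renaming (_<_ to _<ᶠ_)
open import Data.Vec using (Vec; lookup; toList; [_]; _∷_; [])
open import Data.List using (List; length; filter)
open import Data.List.Relation.Unary.Unique.Propositional using (Unique)
open import Data.Product using (Σ; _×_; ∃)
open import Relation.Nullary using (¬_; yes; no)
open import Function.Bundles using (_⇔_)

-- A permutation of length n is written as its one-line notation
-- σ(1)⋯σ(n), a vector of n entries from Fin n (values 0..n-1 stand
-- for 1..n) with no repeated entry (hence a bijection on Fin n).
IsPerm : ∀ {n} → Vec (Fin n) n → Set
IsPerm σ = Unique (toList σ)

module _ {n : ℕ} (σ : Vec (Fin n) n) where
  val : ℕ → ℕ
  val j with j <? n
  ... | yes j<n = toℕ (lookup σ (fromℕ< j<n))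
  ... | no _ = 0

  ascAt : ℕ → ℕ
  ascAt j with val j <? val (suc j)
  ... | yes _ = 1
  ... | no _ = 0

  descAt : ℕ → ℕ
  descAt j with val (suc j) <? val j
  ... | yes _ = 1
  ... | no _ = 0

  -- asc p / desc p: number of ascents / descents of the prefix of
  -- length p, i.e. among pairs (j, j+1) with j + 1 < p.
  asc : ℕ → ℕ
  asc zero = 0
  asc (suc zero) = 0
  asc (suc (suc p)) = ascAt p + asc (suc p)

  desc : ℕ → ℕ
  desc zero = 0
  desc (suc zero) = 0
  desc (suc (suc p)) = descAt p + desc (suc p)

IsBallot : ∀ {n} → Vec (Fin n) n → Set
IsBallot {n} σ = ∀ p → p ≤ n → desc σ p ≤ asc σ p

Contains : ∀ {n k} → Vec (Fin n) n → Vec (Fin k) k → Set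
Contains {n} {k} σ π =
  Σ (Fin k → Fin n) λ c →
    (∀ i j → i <ᶠ j → c i <ᶠ c j) ×
    (∀ i j → (lookup σ (c i) <ᶠ lookup σ (c j)) ⇔ (lookup π i <ᶠ lookup π j))

Avoids : ∀ {n k} → Vec (Fin n) n → Vec (Fin k) k → Set
Avoids σ π = ¬ Contains σ π

p132 p213 p321 : Vec (Fin 3) 3
p132 = fz ∷ fs (fs fz) ∷ fs fz ∷ []
p213 = fs fz ∷ fz ∷ fs (fs fz) ∷ []
p321 = fs (fs fz) ∷ fs fz ∷ fz ∷ []

InB : ∀ {n} → Vec (Fin n) n → Set
InB σ = IsPerm σ × IsBallot σ × Avoids σ p132 × Avoids σ p213 × Avoids σ p321

-- Avoiding 132, 213 and 321 forces consecutive entries to step by one modulo n: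
-- if σ(i+1) is neither σ(i)+1 nor the wrap n ↦ 1, then the value σ(i)+1 or the
-- value 1 occurs outside the positions i, i+1 and completes one of the three
-- patterns.  Hence σ is the rotation k+1, …, n, 1, …, k fixed by σ(1).  Every
-- rotation avoids the patterns and has at most one descent, so it is ballot
-- exactly when it starts with an ascent, i.e. unless σ(1) = n: n − 1 choices.
module Submission where

open import Defs
open import Data.Nat using (ℕ; zero; suc; _+_; _∸_; _≤_; _<_; _<?_; _≤?_; z≤n; s≤s; s≤s⁻¹; z<s; s<s)
open import Data.Nat.Properties
  using (<-cmp; <-irrefl; <-asym; <-trans; ≤-trans; ≤-refl; ≤-reflexive; ≤-antisym; <⇒≱; <⇒≢; <⇒≤;
         ≤-pred; ≮⇒≥; ≤∧≢⇒<; m≤n⇒m<n∨m≡n; n≤0⇒n≡0; n≤1+n; n<1+n; m<n⇒m<1+n; m≤n+m; n∸n≡0;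
         +-monoˡ-<; +-monoˡ-≤; +-mono-<; ∸-monoˡ-<; m+n∸m≡n; +-∸-assoc; +-cancelʳ-≡; suc-injective;
         module ≤-Reasoning)
open import Data.Fin using (Fin; toℕ; fromℕ<; punchOut) renaming (zero to fz; suc to fs; _<_ to _<ᶠ_)
open import Data.Fin.Properties
  using (toℕ-injective; toℕ<n; toℕ-fromℕ<; fromℕ<-toℕ; any?; punchOut-injective; injective⇒≤)
  renaming (_≟_ to _≟ᶠ_)
open import Data.Vec using (Vec; lookup; toList; tabulate; _∷_; [])
open import Data.Vec.Properties using (lookup∘tabulate; tabulate∘lookup; tabulate-cong)
import Data.Vec.Relation.Unary.Unique.Propositional as Vec
open import Data.Vec.Relation.Unary.AllPairs using ([]; _∷_)
open import Data.Vec.Relation.Unary.Unique.Propositional.Properties using (lookup-injective; tabulate⁺)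
open import Data.Vec.Relation.Unary.All.Properties using (toList⁺; toList⁻)
open import Data.List using (List; length; map; allFin)
open import Data.List.Properties using (length-map; length-tabulate)
open import Data.List.Relation.Unary.All using (_∷_; [])
open import Data.List.Relation.Unary.Unique.Propositional using (Unique; _∷_; [])
open import Data.List.Relation.Unary.Unique.Propositional.Properties using (map⁺; allFin⁺)
open import Data.List.Membership.Propositional using (_∈_)
open import Data.List.Membership.Propositional.Properties using (∈-map⁺; ∈-map⁻; ∈-allFin)
open import Data.Product using (Σ; _×_; _,_; ∃; proj₁; proj₂)
open import Data.Sum using (_⊎_; inj₁; inj₂; [_,_])
open import Function using (_∘_; id)
open import Function.Bundles using (_⇔_; mk⇔; Equivalence)
open import Function.Definitions using (Injective)
open import Relation.Nullary using (¬_; Dec; yes; no; contradiction)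
open import Relation.Nullary.Decidable using (_×-dec_)
open import Relation.Binary using (tri<; tri≈; tri>)
open import Relation.Binary.PropositionalEquality
  using (_≡_; _≢_; refl; sym; trans; cong; cong₂; subst; subst₂; module ≡-Reasoning)

module _ {n : ℕ} (σ : Vec (Fin n) n) where

  val-fromℕ< : ∀ {j} (j<n : j < n) → val σ j ≡ toℕ (lookup σ (fromℕ< j<n))
  val-fromℕ< {j} j<n with j <? n
  ... | yes _ = refl
  ... | no j≮n = contradiction j<n j≮n

  val-toℕ : (i : Fin n) → val σ (toℕ i) ≡ toℕ (lookup σ i)
  val-toℕ i = trans (val-fromℕ< (toℕ<n i)) (cong (toℕ ∘ lookup σ) (fromℕ<-toℕ i (toℕ<n i)))

  val<n : ∀ {j} → j < n → val σ j < n
  val<n j<n = subst (_< n) (sym (val-fromℕ< j<n)) (toℕ<n _)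

  Ascent Descent : ℕ → Set
  Ascent j = val σ j < val σ (suc j)
  Descent j = val σ (suc j) < val σ j

  AtMostOneDescent : Set
  AtMostOneDescent = ∀ i j → suc i < n → suc j < n → Descent i → Descent j → i ≡ j

  ascAt-≡1 : ∀ {j} → Ascent j → ascAt σ j ≡ 1
  ascAt-≡1 {j} a with val σ j <? val σ (suc j)
  ... | yes _ = refl
  ... | no ¬a = contradiction a ¬a

  ascAt-≡0 : ∀ {j} → ¬ Ascent j → ascAt σ j ≡ 0
  ascAt-≡0 {j} ¬a with val σ j <? val σ (suc j)
  ... | yes a = contradiction a ¬a
  ... | no _ = refl

  descAt-≡1 : ∀ {j} → Descent j → descAt σ j ≡ 1
  descAt-≡1 {j} d with val σ (suc j) <? val σ j
  ... | yes _ = refl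
  ... | no ¬d = contradiction d ¬d

  descAt-≡0 : ∀ {j} → ¬ Descent j → descAt σ j ≡ 0
  descAt-≡0 {j} ¬d with val σ (suc j) <? val σ j
  ... | yes d = contradiction d ¬d
  ... | no _ = refl

  ballot⇒¬Descent₀ : IsBallot σ → 2 ≤ n → ¬ Descent 0
  ballot⇒¬Descent₀ ballot 2≤n d = contradiction 1≤0 λ ()
    where
    1≤0 : 1 + 0 ≤ 0 + 0
    1≤0 = subst₂ _≤_ (cong (_+ 0) (descAt-≡1 d)) (cong (_+ 0) (ascAt-≡0 (<-asym d))) (ballot 2 2≤n)

  desc≡0 : ∀ p → (∀ j → suc j < p → ¬ Descent j) → desc σ p ≡ 0
  desc≡0 zero _ = refl
  desc≡0 (suc zero) _ = refl
  desc≡0 (suc (suc p)) none =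
    cong₂ _+_ (descAt-≡0 (none p ≤-refl)) (desc≡0 (suc p) (λ j j<p → none j (m<n⇒m<1+n j<p)))

  desc≤1 : AtMostOneDescent → ∀ p → p ≤ n → desc σ p ≤ 1
  desc≤1 _ zero _ = z≤n
  desc≤1 _ (suc zero) _ = z≤n
  desc≤1 one (suc (suc p)) p≤n =
    by-cases (desc≤1 one (suc p) (≤-trans (n≤1+n _) p≤n)) (val σ (suc p) <? val σ p)
    where
    none-before : Descent p → ∀ j → suc j < suc p → ¬ Descent j
    none-before d j j<p d′ with one j p (<-trans j<p p≤n) p≤n d′ d
    ... | refl = <-irrefl refl j<p
    by-cases : desc σ (suc p) ≤ 1 → Dec (Descent p) → desc σ (suc (suc p)) ≤ 1
    by-cases _ (yes d) = ≤-reflexive (cong₂ _+_ (descAt-≡1 d) (desc≡0 (suc p) (none-before d)))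
    by-cases ih (no ¬d) = ≤-trans (≤-reflexive (cong (_+ desc σ (suc p)) (descAt-≡0 ¬d))) ih

  asc≥1 : Ascent 0 → ∀ p → 1 ≤ asc σ (suc (suc p))
  asc≥1 a zero = ≤-reflexive (sym (cong (_+ 0) (ascAt-≡1 a)))
  asc≥1 a (suc p) = ≤-trans (asc≥1 a p) (m≤n+m _ (ascAt σ (suc p)))

  Ascent₀∧AtMostOneDescent⇒ballot : Ascent 0 → AtMostOneDescent → IsBallot σ
  Ascent₀∧AtMostOneDescent⇒ballot _ _ zero _ = z≤n
  Ascent₀∧AtMostOneDescent⇒ballot _ _ (suc zero) _ = z≤n
  Ascent₀∧AtMostOneDescent⇒ballot a one (suc (suc p)) p≤n =
    ≤-trans (desc≤1 one (suc (suc p)) p≤n) (asc≥1 a p)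

unique-toList⁻ : ∀ {A : Set} {n} {xs : Vec A n} → Unique (toList xs) → Vec.Unique xs
unique-toList⁻ {xs = []} [] = []
unique-toList⁻ {xs = _ ∷ _} (x∉xs ∷ xs!) = toList⁻ x∉xs ∷ unique-toList⁻ xs!

unique-toList⁺ : ∀ {A : Set} {n} {xs : Vec A n} → Vec.Unique xs → Unique (toList xs)
unique-toList⁺ [] = []
unique-toList⁺ (x∉xs ∷ xs!) = toList⁺ x∉xs ∷ unique-toList⁺ xs!

injective⇒surjective : ∀ {n} {f : Fin n → Fin n} → Injective _≡_ _≡_ f → ∀ v → ∃ λ i → f i ≡ v
injective⇒surjective {suc m} {f} f-inj v with any? (λ i → f i ≟ᶠ v)
... | yes hit = hit
... | no miss = contradiction (injective⇒≤ g-inj) (<-irrefl refl)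
  where
  f≢v : ∀ i → v ≢ f i
  f≢v i e = miss (i , sym e)
  g : Fin (suc m) → Fin m
  g i = punchOut (f≢v i)
  g-inj : Injective _≡_ _≡_ g
  g-inj {i} {j} e = f-inj (punchOut-injective (f≢v i) (f≢v j) e)

module _ {n : ℕ} {σ : Vec (Fin n) n} (σ-perm : IsPerm σ) where

  private
    lookup-σ-injective : ∀ i j → lookup σ i ≡ lookup σ j → i ≡ j
    lookup-σ-injective = lookup-injective (unique-toList⁻ σ-perm)

  val-injective : ∀ {i j} → i < n → j < n → val σ i ≡ val σ j → i ≡ j
  val-injective {i} {j} i<n j<n e = begin
    i                     ≡⟨ toℕ-fromℕ< i<n ⟨
    toℕ (fromℕ< i<n)      ≡⟨ cong toℕ (lookup-σ-injective _ _ (toℕ-injective lookups≡)) ⟩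
    toℕ (fromℕ< j<n)      ≡⟨ toℕ-fromℕ< j<n ⟩
    j                     ∎
    where
    open ≡-Reasoning
    lookups≡ : toℕ (lookup σ (fromℕ< i<n)) ≡ toℕ (lookup σ (fromℕ< j<n))
    lookups≡ = trans (sym (val-fromℕ< σ i<n)) (trans e (val-fromℕ< σ j<n))

  val-surjective : ∀ {v} → v < n → ∃ λ j → j < n × val σ j ≡ v
  val-surjective {v} v<n with injective⇒surjective (lookup-σ-injective _ _) (fromℕ< v<n)
  ... | i , σi≡v = toℕ i , toℕ<n i , trans (val-toℕ σ i) (trans (cong toℕ σi≡v) (toℕ-fromℕ< v<n))

record Occurrence {n k} (σ : Vec (Fin n) n) (π : Vec (Fin k) k) (c : Fin k → ℕ) : Set where
  field
    bounded : ∀ s → c s < n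
    increasing : ∀ s t → s <ᶠ t → c s < c t
    order-preserving : ∀ s t → lookup π s <ᶠ lookup π t → val σ (c s) < val σ (c t)

module _ {n k} {σ : Vec (Fin n) n} {π : Vec (Fin k) k} where

  contains⇒occurrence : Contains σ π → ∃ (Occurrence σ π)
  contains⇒occurrence (c , c-inc , c-iso) = toℕ ∘ c , record
    { bounded = toℕ<n ∘ c
    ; increasing = c-inc
    ; order-preserving = λ s t π< →
        subst₂ _<_ (sym (val-toℕ σ (c s))) (sym (val-toℕ σ (c t))) (Equivalence.from (c-iso s t) π<)
    }

  occurrence⇒contains : IsPerm π → ∀ {c} → Occurrence σ π c → Contains σ π
  occurrence⇒contains π-perm {c} occ = position , position-inc , λ s t → mk⇔ (reflect s t) (preserve s t)
    where
    open Occurrence occ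
    position : Fin k → Fin n
    position s = fromℕ< (bounded s)
    position-inc : ∀ s t → s <ᶠ t → position s <ᶠ position t
    position-inc s t s<t =
      subst₂ _<_ (sym (toℕ-fromℕ< (bounded s))) (sym (toℕ-fromℕ< (bounded t))) (increasing s t s<t)
    preserve : ∀ s t → lookup π s <ᶠ lookup π t → lookup σ (position s) <ᶠ lookup σ (position t)
    preserve s t π< =
      subst₂ _<_ (val-fromℕ< σ (bounded s)) (val-fromℕ< σ (bounded t)) (order-preserving s t π<)
    reflect : ∀ s t → lookup σ (position s) <ᶠ lookup σ (position t) → lookup π s <ᶠ lookup π t
    reflect s t σ< with <-cmp (toℕ (lookup π s)) (toℕ (lookup π t))
    ... | tri< π< _ _ = π<
    ... | tri≈ _ π≡ _ with lookup-injective (unique-toList⁻ π-perm) s t (toℕ-injective π≡)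
    ...   | refl = contradiction σ< (<-irrefl refl)
    reflect s t σ< | tri> _ _ π> = contradiction (preserve t s π>) (<-asym σ<)

p132-perm : IsPerm p132
p132-perm = ((λ ()) ∷ (λ ()) ∷ []) ∷ ((λ ()) ∷ []) ∷ [] ∷ []

p213-perm : IsPerm p213
p213-perm = ((λ ()) ∷ (λ ()) ∷ []) ∷ ((λ ()) ∷ []) ∷ [] ∷ []

p321-perm : IsPerm p321
p321-perm = ((λ ()) ∷ (λ ()) ∷ []) ∷ ((λ ()) ∷ []) ∷ [] ∷ []

triple : ℕ → ℕ → ℕ → Fin 3 → ℕ
triple a b c fz = a
triple a b c (fs fz) = b
triple a b c (fs (fs fz)) = c

module _ {n} (σ : Vec (Fin n) n) {a b c : ℕ} (a<b : a < b) (b<c : b < c) (c<n : c < n) where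

  private
    S : ℕ → ℕ
    S = val σ

    triple-bounded : ∀ s → triple a b c s < n
    triple-bounded fz = <-trans a<b (<-trans b<c c<n)
    triple-bounded (fs fz) = <-trans b<c c<n
    triple-bounded (fs (fs fz)) = c<n

    triple-increasing : ∀ s t → s <ᶠ t → triple a b c s < triple a b c t
    triple-increasing fz (fs fz) _ = a<b
    triple-increasing fz (fs (fs fz)) _ = <-trans a<b b<c
    triple-increasing (fs fz) (fs (fs fz)) _ = b<c
    triple-increasing fz fz ()
    triple-increasing (fs fz) fz ()
    triple-increasing (fs fz) (fs fz) (s<s ())
    triple-increasing (fs (fs fz)) fz ()
    triple-increasing (fs (fs fz)) (fs fz) (s<s ())
    triple-increasing (fs (fs fz)) (fs (fs fz)) (s<s (s<s ()))

    occurrence : ∀ {π} → (∀ s t → lookup π s <ᶠ lookup π t → S (triple a b c s) < S (triple a b c t)) →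
                 Occurrence σ π (triple a b c)
    occurrence order = record
      { bounded = triple-bounded ; increasing = triple-increasing ; order-preserving = order }

  contains-132 : S a < S c → S c < S b → Contains σ p132
  contains-132 ac cb = occurrence⇒contains p132-perm (occurrence order)
    where
    order : ∀ s t → lookup p132 s <ᶠ lookup p132 t → S (triple a b c s) < S (triple a b c t)
    order fz (fs fz) _ = <-trans ac cb
    order fz (fs (fs fz)) _ = ac
    order (fs (fs fz)) (fs fz) _ = cb
    order fz fz ()
    order (fs fz) fz ()
    order (fs fz) (fs fz) (s<s (s<s ()))
    order (fs fz) (fs (fs fz)) (s<s ())
    order (fs (fs fz)) fz ()
    order (fs (fs fz)) (fs (fs fz)) (s<s ())

  contains-213 : S b < S a → S a < S c → Contains σ p213
  contains-213 ba ac = occurrence⇒contains p213-perm (occurrence order)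
    where
    order : ∀ s t → lookup p213 s <ᶠ lookup p213 t → S (triple a b c s) < S (triple a b c t)
    order fz (fs (fs fz)) _ = ac
    order (fs fz) fz _ = ba
    order (fs fz) (fs (fs fz)) _ = <-trans ba ac
    order fz fz (s<s ())
    order fz (fs fz) ()
    order (fs fz) (fs fz) ()
    order (fs (fs fz)) fz (s<s ())
    order (fs (fs fz)) (fs fz) ()
    order (fs (fs fz)) (fs (fs fz)) (s<s (s<s ()))

  contains-321 : S b < S a → S c < S b → Contains σ p321
  contains-321 ba cb = occurrence⇒contains p321-perm (occurrence order)
    where
    order : ∀ s t → lookup p321 s <ᶠ lookup p321 t → S (triple a b c s) < S (triple a b c t)
    order (fs fz) fz _ = ba
    order (fs (fs fz)) fz _ = <-trans cb ba
    order (fs (fs fz)) (fs fz) _ = cb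
    order fz fz (s<s (s<s ()))
    order fz (fs fz) (s<s ())
    order fz (fs (fs fz)) ()
    order (fs fz) (fs fz) (s<s ())
    order (fs fz) (fs (fs fz)) ()
    order (fs (fs fz)) (fs (fs fz)) ()

suc-mod : ℕ → ℕ → ℕ
suc-mod n x with suc x <? n
... | yes _ = suc x
... | no _ = 0

suc-mod-< : ∀ {n x} → suc x < n → suc-mod n x ≡ suc x
suc-mod-< {n} {x} x+1<n with suc x <? n
... | yes _ = refl
... | no x+1≮n = contradiction x+1<n x+1≮n

suc-mod-≡ : ∀ {n x} → suc x ≡ n → suc-mod n x ≡ 0
suc-mod-≡ {n} {x} x+1≡n with suc x <? n
... | yes x+1<n = contradiction x+1≡n (<⇒≢ x+1<n)
... | no _ = refl

val-ext : ∀ {n} {σ τ : Vec (Fin n) n} → (∀ j → j < n → val σ j ≡ val τ j) → σ ≡ τ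
val-ext {n} {σ} {τ} eq = begin
  σ                   ≡⟨ tabulate∘lookup σ ⟨
  tabulate (lookup σ) ≡⟨ tabulate-cong pointwise ⟩
  tabulate (lookup τ) ≡⟨ tabulate∘lookup τ ⟩
  τ                   ∎
  where
  open ≡-Reasoning
  pointwise : ∀ i → lookup σ i ≡ lookup τ i
  pointwise i = toℕ-injective (trans (sym (val-toℕ σ i)) (trans (eq (toℕ i) (toℕ<n i)) (val-toℕ τ i)))

Cyclic : ∀ {n} → Vec (Fin n) n → Set
Cyclic {n} σ = ∀ m → suc m < n → val σ (suc m) ≡ suc-mod n (val σ m)

cyclic-≡ : ∀ {n} {σ τ : Vec (Fin n) n} → Cyclic σ → Cyclic τ → val σ 0 ≡ val τ 0 → σ ≡ τ
cyclic-≡ {n} {σ} {τ} σ-cyclic τ-cyclic first≡ = val-ext agree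
  where
  open ≡-Reasoning
  agree : ∀ j → j < n → val σ j ≡ val τ j
  agree zero _ = first≡
  agree (suc m) m+1<n = begin
    val σ (suc m)         ≡⟨ σ-cyclic m m+1<n ⟩
    suc-mod n (val σ m)   ≡⟨ cong (suc-mod n) (agree m (<-trans (n<1+n m) m+1<n)) ⟩
    suc-mod n (val τ m)   ≡⟨ τ-cyclic m m+1<n ⟨
    val τ (suc m)         ∎

module _ {n : ℕ} {σ : Vec (Fin n) n} (σ-perm : IsPerm σ)
         (¬132 : Avoids σ p132) (¬213 : Avoids σ p213) (¬321 : Avoids σ p321) where

  private
    S : ℕ → ℕ
    S = val σ

    outside-pair : ∀ {m p} → S p ≢ S m → S p ≢ S (suc m) → p < m ⊎ suc m < p
    outside-pair {m} {p} p≢m p≢m+1 with <-cmp p m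
    ... | tri< p<m _ _ = inj₁ p<m
    ... | tri≈ _ refl _ = contradiction refl p≢m
    ... | tri> _ _ m<p with m≤n⇒m<n∨m≡n m<p
    ...   | inj₁ m+1<p = inj₂ m+1<p
    ...   | inj₂ refl = contradiction refl p≢m+1

  ascent⇒step-by-one : ∀ {m} → suc m < n → S m < S (suc m) → S (suc m) ≡ suc (S m)
  ascent⇒step-by-one {m} m+1<n up = ≤-antisym (≮⇒≥ no-gap) up
    where
    no-gap : ¬ suc (S m) < S (suc m)
    no-gap gap with val-surjective σ-perm (<-trans gap (val<n σ m+1<n))
    ... | p , p<n , Sp≡ = [ (λ p<m → ¬213 (contains-213 σ p<m (n<1+n m) m+1<n Sm<Sp Sp<Sm+1))
                          , (λ m+1<p → ¬132 (contains-132 σ (n<1+n m) m+1<p p<n Sm<Sp Sp<Sm+1)) ]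
                          (outside-pair (<⇒≢ Sm<Sp ∘ sym) (<⇒≢ Sp<Sm+1))
      where
      Sm<Sp : S m < S p
      Sm<Sp = subst (S m <_) (sym Sp≡) (n<1+n (S m))
      Sp<Sm+1 : S p < S (suc m)
      Sp<Sm+1 = subst (_< S (suc m)) (sym Sp≡) gap

  descent⇒from-top : ∀ {m} → suc m < n → S (suc m) < S m → suc (S m) ≡ n
  descent⇒from-top {m} m+1<n down = ≤-antisym (val<n σ (<-trans (n<1+n m) m+1<n)) (≮⇒≥ not-top)
    where
    not-top : ¬ suc (S m) < n
    not-top below with val-surjective σ-perm below
    ... | p , p<n , Sp≡ = [ (λ p<m → ¬321 (contains-321 σ p<m (n<1+n m) m+1<n Sm<Sp down))
                          , (λ m+1<p → ¬213 (contains-213 σ (n<1+n m) m+1<p p<n down Sm<Sp)) ]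
                          (outside-pair (<⇒≢ Sm<Sp ∘ sym) (<⇒≢ (<-trans down Sm<Sp) ∘ sym))
      where
      Sm<Sp : S m < S p
      Sm<Sp = subst (S m <_) (sym Sp≡) (n<1+n (S m))

  descent⇒to-zero : ∀ {m} → suc m < n → S (suc m) < S m → S (suc m) ≡ 0
  descent⇒to-zero {m} m+1<n down = n≤0⇒n≡0 (≮⇒≥ not-zero)
    where
    not-zero : ¬ 0 < S (suc m)
    not-zero above with val-surjective σ-perm (<-trans z<s m+1<n)
    ... | p , p<n , Sp≡ = [ (λ p<m → ¬132 (contains-132 σ p<m (n<1+n m) m+1<n Sp<Sm+1 down))
                          , (λ m+1<p → ¬321 (contains-321 σ (n<1+n m) m+1<p p<n down Sp<Sm+1)) ]
                          (outside-pair (<⇒≢ (<-trans Sp<Sm+1 down)) (<⇒≢ Sp<Sm+1))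
      where
      Sp<Sm+1 : S p < S (suc m)
      Sp<Sm+1 = subst (_< S (suc m)) (sym Sp≡) above

  avoider⇒cyclic : Cyclic σ
  avoider⇒cyclic m m+1<n with <-cmp (S m) (S (suc m))
  ... | tri< up _ _ = trans step (sym (suc-mod-< (subst (_< n) step (val<n σ m+1<n))))
    where
    step : S (suc m) ≡ suc (S m)
    step = ascent⇒step-by-one m+1<n up
  ... | tri≈ _ same _ =
    contradiction (val-injective σ-perm (<-trans (n<1+n m) m+1<n) m+1<n same) (<⇒≢ (n<1+n m))
  ... | tri> _ _ down =
    trans (descent⇒to-zero m+1<n down) (sym (suc-mod-≡ (descent⇒from-top m+1<n down)))

module Rotation (n k : ℕ) (k<n : k < n) where

  value : ℕ → ℕ
  value m with m + k <? n
  ... | yes _ = m + k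
  ... | no _ = m + k ∸ n

  value-< : ∀ {m} → m + k < n → value m ≡ m + k
  value-< {m} m+k<n with m + k <? n
  ... | yes _ = refl
  ... | no m+k≮n = contradiction m+k<n m+k≮n

  value-≥ : ∀ {m} → n ≤ m + k → value m ≡ m + k ∸ n
  value-≥ {m} n≤m+k with m + k <? n
  ... | yes m+k<n = contradiction n≤m+k (<⇒≱ m+k<n)
  ... | no _ = refl

  value<n : ∀ {m} → m < n → value m < n
  value<n {m} m<n with m + k <? n
  ... | yes m+k<n = m+k<n
  ... | no m+k≮n = subst (m + k ∸ n <_) (m+n∸m≡n n n) (∸-monoˡ-< (+-mono-< m<n k<n) (≮⇒≥ m+k≮n))

  -- The wrap-around point, where the value drops from n-1 to 0, lies in (i, j].
  Wraps : ℕ → ℕ → Set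
  Wraps i j = i + k < n × n ≤ j + k

  value-increasing : ∀ {i j} → i < j → j < n → ¬ Wraps i j → value i < value j
  value-increasing {i} {j} i<j j<n no-wrap = by-cases (j + k <? n)
    where
    by-cases : Dec (j + k < n) → value i < value j
    by-cases (yes j+k<n) = subst₂ _<_ (sym (value-< (<-trans (+-monoˡ-< k i<j) j+k<n)))
                                      (sym (value-< j+k<n)) (+-monoˡ-< k i<j)
    by-cases (no j+k≮n) = subst₂ _<_ (sym (value-≥ n≤i+k)) (sym (value-≥ (≮⇒≥ j+k≮n)))
                                 (∸-monoˡ-< (+-monoˡ-< k i<j) n≤i+k)
      where
      n≤i+k : n ≤ i + k
      n≤i+k = ≮⇒≥ (λ i+k<n → no-wrap (i+k<n , ≮⇒≥ j+k≮n))

  value-decreasing : ∀ {i j} → j < n → Wraps i j → value j < value i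
  value-decreasing {i} {j} j<n (i+k<n , n≤j+k) = begin-strict
    value j     ≡⟨ value-≥ n≤j+k ⟩
    j + k ∸ n   <⟨ ∸-monoˡ-< (+-monoˡ-< k j<n) n≤j+k ⟩
    n + k ∸ n   ≡⟨ m+n∸m≡n n k ⟩
    k           ≤⟨ m≤n+m k i ⟩
    i + k       ≡⟨ value-< i+k<n ⟨
    value i     ∎
    where open ≤-Reasoning

  Wraps? : ∀ i j → Dec (Wraps i j)
  Wraps? i j = (i + k <? n) ×-dec (n ≤? j + k)

  descent⇒wraps : ∀ {i j} → i < j → j < n → value j < value i → Wraps i j
  descent⇒wraps {i} {j} i<j j<n down with Wraps? i j
  ... | yes wraps = wraps
  ... | no no-wrap = contradiction (value-increasing i<j j<n no-wrap) (<-asym down)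

  ascent⇒¬wraps : ∀ {i j} → j < n → value i < value j → ¬ Wraps i j
  ascent⇒¬wraps j<n up wraps = <-asym up (value-decreasing j<n wraps)

  value-≢ : ∀ {i j} → i < j → j < n → value i ≢ value j
  value-≢ {i} {j} i<j j<n with Wraps? i j
  ... | yes wraps = <⇒≢ (value-decreasing j<n wraps) ∘ sym
  ... | no no-wrap = <⇒≢ (value-increasing i<j j<n no-wrap)

  value-injective : ∀ {i j} → i < n → j < n → value i ≡ value j → i ≡ j
  value-injective {i} {j} i<n j<n same with <-cmp i j
  ... | tri< i<j _ _ = contradiction same (value-≢ i<j j<n)
  ... | tri≈ _ i≡j _ = i≡j
  ... | tri> _ _ j<i = contradiction (sym same) (value-≢ j<i i<n)

  value-suc : ∀ {m} → suc m < n → value (suc m) ≡ suc-mod n (value m)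
  value-suc {m} m+1<n with <-cmp (suc (m + k)) n
  ... | tri< m+k+1<n _ _ = begin
    value (suc m)         ≡⟨ value-< m+k+1<n ⟩
    suc (m + k)           ≡⟨ suc-mod-< m+k+1<n ⟨
    suc-mod n (m + k)     ≡⟨ cong (suc-mod n) (value-< (<-trans (n<1+n _) m+k+1<n)) ⟨
    suc-mod n (value m)   ∎
    where open ≡-Reasoning
  ... | tri≈ _ m+k+1≡n _ = begin
    value (suc m)         ≡⟨ value-≥ (≤-reflexive (sym m+k+1≡n)) ⟩
    suc (m + k) ∸ n       ≡⟨ cong (_∸ n) m+k+1≡n ⟩
    n ∸ n                 ≡⟨ n∸n≡0 n ⟩
    0                     ≡⟨ suc-mod-≡ m+k+1≡n ⟨
    suc-mod n (m + k)     ≡⟨ cong (suc-mod n) (value-< (≤-reflexive m+k+1≡n)) ⟨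
    suc-mod n (value m)   ∎
    where open ≡-Reasoning
  ... | tri> _ _ n<m+k+1 = begin
    value (suc m)          ≡⟨ value-≥ (<⇒≤ n<m+k+1) ⟩
    suc (m + k) ∸ n        ≡⟨ +-∸-assoc 1 n≤m+k ⟩
    suc (m + k ∸ n)        ≡⟨ suc-mod-< below ⟨
    suc-mod n (m + k ∸ n)  ≡⟨ cong (suc-mod n) (value-≥ n≤m+k) ⟨
    suc-mod n (value m)    ∎
    where
    open ≡-Reasoning
    n≤m+k : n ≤ m + k
    n≤m+k = ≤-pred n<m+k+1
    below : suc (m + k ∸ n) < n
    below = subst₂ _<_ (+-∸-assoc 1 n≤m+k) (m+n∸m≡n n n)
                       (∸-monoˡ-< (+-mono-< m+1<n k<n) (<⇒≤ n<m+k+1))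

  rotation : Vec (Fin n) n
  rotation = tabulate (λ i → fromℕ< (value<n (toℕ<n i)))

  val-rotation : ∀ {j} → j < n → val rotation j ≡ value j
  val-rotation {j} j<n = begin
    val rotation j                              ≡⟨ val-fromℕ< rotation j<n ⟩
    toℕ (lookup rotation (fromℕ< j<n))          ≡⟨ cong toℕ (lookup∘tabulate _ (fromℕ< j<n)) ⟩
    toℕ (fromℕ< (value<n (toℕ<n (fromℕ< j<n)))) ≡⟨ toℕ-fromℕ< _ ⟩
    value (toℕ (fromℕ< j<n))                    ≡⟨ cong value (toℕ-fromℕ< j<n) ⟩
    value j                                     ∎
    where open ≡-Reasoning

  rotation-perm : IsPerm rotation
  rotation-perm = unique-toList⁺ (tabulate⁺ injective)
    where
    injective : ∀ {i j} → fromℕ< (value<n (toℕ<n i)) ≡ fromℕ< (value<n (toℕ<n j)) → i ≡ j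
    injective {i} {j} e = toℕ-injective (value-injective (toℕ<n i) (toℕ<n j)
      (trans (sym (toℕ-fromℕ< _)) (trans (cong toℕ e) (toℕ-fromℕ< _))))

  rotation-cyclic : Cyclic rotation
  rotation-cyclic m m+1<n = begin
    val rotation (suc m)          ≡⟨ val-rotation m+1<n ⟩
    value (suc m)                 ≡⟨ value-suc m+1<n ⟩
    suc-mod n (value m)           ≡⟨ cong (suc-mod n) (val-rotation (<-trans (n<1+n m) m+1<n)) ⟨
    suc-mod n (val rotation m)    ∎
    where open ≡-Reasoning

  rotation-first : val rotation 0 ≡ k
  rotation-first = trans (val-rotation (≤-trans (s≤s z≤n) k<n)) (value-< k<n)

  private
    module _ {π : Vec (Fin 3) 3} {x : Fin 3 → ℕ} (occ : Occurrence rotation π x) where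
      open Occurrence occ

      ordered : ∀ s t → lookup π s <ᶠ lookup π t → value (x s) < value (x t)
      ordered s t π< =
        subst₂ _<_ (val-rotation (bounded s)) (val-rotation (bounded t)) (order-preserving s t π<)

      descending-pair : ∀ s t → s <ᶠ t → lookup π t <ᶠ lookup π s → Wraps (x s) (x t)
      descending-pair s t s<t π> = descent⇒wraps (increasing s t s<t) (bounded t) (ordered t s π>)

      ascending-pair : ∀ s t → lookup π s <ᶠ lookup π t → ¬ Wraps (x s) (x t)
      ascending-pair s t π< = ascent⇒¬wraps (bounded t) (ordered s t π<)

  rotation-avoids-132 : Avoids rotation p132
  rotation-avoids-132 c with contains⇒occurrence {π = p132} c
  ... | x , occ =
    ascending-pair occ fz (fs (fs fz)) z<s (<-trans (+-monoˡ-< k x₀<x₁) (proj₁ w₁₂) , proj₂ w₁₂)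
    where
    x₀<x₁ : x fz < x (fs fz)
    x₀<x₁ = Occurrence.increasing occ fz (fs fz) z<s
    w₁₂ : Wraps (x (fs fz)) (x (fs (fs fz)))
    w₁₂ = descending-pair occ (fs fz) (fs (fs fz)) (s<s z<s) (s<s z<s)

  rotation-avoids-213 : Avoids rotation p213
  rotation-avoids-213 c with contains⇒occurrence {π = p213} c
  ... | x , occ =
    ascending-pair occ fz (fs (fs fz)) (s<s z<s) (proj₁ w₀₁ , ≤-trans (proj₂ w₀₁) (+-monoˡ-≤ k (<⇒≤ x₁<x₂)))
    where
    x₁<x₂ : x (fs fz) < x (fs (fs fz))
    x₁<x₂ = Occurrence.increasing occ (fs fz) (fs (fs fz)) (s<s z<s)
    w₀₁ : Wraps (x fz) (x (fs fz))
    w₀₁ = descending-pair occ fz (fs fz) z<s z<s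

  rotation-avoids-321 : Avoids rotation p321
  rotation-avoids-321 c with contains⇒occurrence {π = p321} c
  ... | x , occ = <⇒≱ (proj₁ (descending-pair occ (fs fz) (fs (fs fz)) (s<s z<s) z<s))
                      (proj₂ (descending-pair occ fz (fs fz) z<s (s<s z<s)))

  rotation-ballot : suc k < n → IsBallot rotation
  rotation-ballot k+1<n = Ascent₀∧AtMostOneDescent⇒ballot rotation first-ascent at-most-one
    where
    first-ascent : Ascent rotation 0
    first-ascent = subst₂ _<_ (sym (trans (val-rotation 0<n) (value-< k<n)))
                              (sym (trans (val-rotation 1<n) (value-< k+1<n))) (n<1+n k)
      where
      0<n : 0 < n
      0<n = ≤-trans (s≤s z≤n) k<n
      1<n : 1 < n
      1<n = ≤-trans (s≤s (s≤s z≤n)) k+1<n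
    descent-position : ∀ {i} → suc i < n → Descent rotation i → suc i + k ≡ n
    descent-position {i} i+1<n down with descent⇒wraps (n<1+n i) i+1<n
      (subst₂ _<_ (val-rotation i+1<n) (val-rotation (<-trans (n<1+n i) i+1<n)) down)
    ... | i+k<n , n≤i+1+k = ≤-antisym i+k<n n≤i+1+k
    at-most-one : AtMostOneDescent rotation
    at-most-one i j i+1<n j+1<n di dj =
      suc-injective (+-cancelʳ-≡ k (suc i) (suc j)
        (trans (descent-position i+1<n di) (sym (descent-position j+1<n dj))))

cyclic∧ballot⇒first<top : ∀ {n} {σ : Vec (Fin n) n} →
                           Cyclic σ → IsBallot σ → 2 ≤ n → suc (val σ 0) < n
cyclic∧ballot⇒first<top {n} {σ} cyclic ballot 2≤n = ≤∧≢⇒< (val<n σ (<-trans z<s 2≤n)) not-top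
  where
  not-top : suc (val σ 0) ≢ n
  not-top top = ballot⇒¬Descent₀ σ ballot 2≤n (subst (_< val σ 0) (sym second≡0) 0<first)
    where
    second≡0 : val σ 1 ≡ 0
    second≡0 = trans (cyclic 0 2≤n) (suc-mod-≡ top)
    0<first : 0 < val σ 0
    0<first = s≤s⁻¹ (subst (2 ≤_) (sym top) 2≤n)

module _ (n : ℕ) where

  private
    module BallotRotation (k : Fin (suc n)) = Rotation (suc (suc n)) (toℕ k) (m<n⇒m<1+n (toℕ<n k))
    open BallotRotation

  ballot-rotation : Fin (suc n) → Vec (Fin (suc (suc n))) (suc (suc n))
  ballot-rotation = rotation

  ballot-rotation∈B : ∀ k → InB (ballot-rotation k)
  ballot-rotation∈B k = rotation-perm k , rotation-ballot k (s≤s (toℕ<n k)) ,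
                        rotation-avoids-132 k , rotation-avoids-213 k , rotation-avoids-321 k

  ballot-rotation-injective : Injective _≡_ _≡_ ballot-rotation
  ballot-rotation-injective {a} {b} e =
    toℕ-injective (trans (sym (rotation-first a)) (trans (cong (λ σ → val σ 0) e) (rotation-first b)))

  InB⇒ballot-rotation : ∀ {σ} → InB σ → ∃ λ k → σ ≡ ballot-rotation k
  InB⇒ballot-rotation {σ} (perm , ballot , ¬132 , ¬213 , ¬321) =
    k , cyclic-≡ cyclic (rotation-cyclic k) (sym (trans (rotation-first k) (toℕ-fromℕ< first<n+1)))
    where
    cyclic : Cyclic σ
    cyclic = avoider⇒cyclic perm ¬132 ¬213 ¬321
    first<n+1 : val σ 0 < suc n
    first<n+1 = s≤s⁻¹ (cyclic∧ballot⇒first<top cyclic ballot (s≤s (s≤s z≤n)))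
    k : Fin (suc n)
    k = fromℕ< first<n+1

theorem4p6 : (n : ℕ) → 2 ≤ n →
    Σ (List (Vec (Fin n) n)) λ L →
      Unique L × (∀ σ → (σ ∈ L) ⇔ InB σ) × (length L ≡ n ∸ 1)
theorem4p6 (suc zero) (s≤s ())
theorem4p6 (suc (suc n)) _ =
  rotations ,
  map⁺ (ballot-rotation-injective n) (allFin⁺ (suc n)) ,
  (λ σ → mk⇔ (from-rotations {σ}) (to-rotations {σ})) ,
  trans (length-map (ballot-rotation n) (allFin (suc n))) (length-tabulate id)
  where
  rotations : List (Vec (Fin (suc (suc n))) (suc (suc n)))
  rotations = map (ballot-rotation n) (allFin (suc n))
  from-rotations : ∀ {σ} → σ ∈ rotations → InB σ
  from-rotations σ∈ = let k , _ , σ≡ = ∈-map⁻ (ballot-rotation n) σ∈ in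
    subst InB (sym σ≡) (ballot-rotation∈B n k)
  to-rotations : ∀ {σ} → InB σ → σ ∈ rotations
  to-rotations {σ} σ∈B = let k , σ≡ = InB⇒ballot-rotation n {σ} σ∈B in
    subst (_∈ rotations) (sym σ≡) (∈-map⁺ (ballot-rotation n) (∈-allFin k))
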